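{- If $\pi \in \mathfrak{S}_n$ is an involution (i.e. $\pi=\pi^{ -1}$), then, viewing $\pi$ as the preference list in which car $i$ prefers spot $\pi_i$, we have $\mathcal{O}_{\mathrm{MVP}_n}(\pi)=\pi$.
   Context: Permutations are written in one-line notation $\pi=(\pi_1,\dots,\pi_n)$. Spots $1,\dots,n$ on a one-way street; cars $1,\dots,n$ arrive in order with preferences $\alpha=(a_1,\dots,a_n)\in[n]^n$. MVP parking rule: when car $i$ arrives, if spot $a_i$ is unoccupied, car $i$ parks there; if spot $a_i$ is occupied by an earlier car $j$, then car $i$ parks in spot $a_i$ and car $j$ is bumped and parks in the first unoccupied spot among $a_i+1,\dots,n$, if any (otherwise car $j$ fails to park); a bumped car never bumps another car. $\alpha$ is an MVP parking function if all cars park. The outcome $\mathcal{O}_{\mathrm{MVP}_n}(\alpha)=(\sigma_1,\dots,\sigma_n)$ is the permutation where car $\sigma_j$ is parked in spot $j$ at the end. -}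

module Defs where

open import Data.Nat using (ℕ; _<?_)
open import Data.Fin using (Fin; toℕ)
open import Data.Maybe using (Maybe; just; nothing; _>>=_)
open import Data.List using (List; []; _∷_; foldl)
open import Data.List.Base using (allFin)
open import Data.Vec using (Vec; []; _∷_; lookup; replicate; _[_]≔_)
open import Relation.Nullary using (yes; no)

-- Conventions: spots and cars are indexed by Fin n (0-based: car/spot k here
-- is car/spot k+1 in the paper). A preference list is a Vec (Fin n) n whose
-- i-th entry is the preferred spot of car i. The parking state is a
-- Vec (Maybe (Fin n)) n: entry at spot s is the car currently parked there.

State : ℕ → Set
State n = Vec (Maybe (Fin n)) n

-- first unoccupied spot among the given candidate list that is strictly
-- after spot a (candidates are supplied in increasing order)
firstFreeAfter : ∀ {n} → State n → Fin n → List (Fin n) → Maybe (Fin n)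
firstFreeAfter st a [] = nothing
firstFreeAfter st a (k ∷ ks) with toℕ a <? toℕ k | lookup st k
... | yes _ | nothing = just k
... | yes _ | just _  = firstFreeAfter st a ks
... | no _  | _       = firstFreeAfter st a ks

-- one MVP step: car i arrives preferring spot a.
-- Returns nothing if some car fails to park (then the list is not an
-- MVP parking function and no outcome is defined).
mvpStep : ∀ {n} → Fin n → Fin n → State n → Maybe (State n)
mvpStep {n} i a st with lookup st a
... | nothing = just (st [ a ]≔ just i)
... | just j with firstFreeAfter st a (allFin n)
...   | nothing = nothing
...   | just k  = just ((st [ a ]≔ just i) [ k ]≔ just j)

mvpRun : ∀ {n} → Vec (Fin n) n → Maybe (State n)
mvpRun {n} α = foldl (λ mst i → mst >>= mvpStep i (lookup α i)) (just (replicate n nothing)) (allFin n)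

allParked : ∀ {m n} → Vec (Maybe (Fin n)) m → Maybe (Vec (Fin n) m)
allParked [] = just []
allParked (nothing ∷ xs) = nothing
allParked (just x ∷ xs) with allParked xs
... | nothing = nothing
... | just ys = just (x ∷ ys)

-- O_MVP(α): just σ (σ_s = car parked in spot s) if α is an MVP parking
-- function, nothing otherwise.
mvpOutcome : ∀ {n} → Vec (Fin n) n → Maybe (Vec (Fin n) n)
mvpOutcome α = mvpRun α >>= allParked

-- Every preference list that is a permutation π is an MVP parking function with
-- outcome π⁻¹: when car i arrives, its preferred spot π i is still free, since
-- only the cars j < i have parked, each in the spot π j ≠ π i. So nobody is ever
-- bumped and car i ends in spot π i. For an involution π⁻¹ = π.
module Submission where

open import Defs
open import Function using (_∘_)
open import Data.Nat using (ℕ; zero; suc)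
open import Data.Fin using (Fin; zero; suc)
open import Data.Fin.Properties using (_≟_)
open import Data.Fin.Permutation using (Permutation′; _⟨$⟩ʳ_; _⟨$⟩ˡ_; inverseˡ; inverseʳ)
open import Data.Vec using (Vec; tabulate; lookup; replicate; _[_]≔_)
open import Data.Vec.Properties
  using (lookup∘update; lookup∘update′; lookup-replicate; lookup∘tabulate; tabulate∘lookup; tabulate-cong)
open import Data.Maybe using (Maybe; just; nothing; _>>=_)
open import Data.List using (List; []; _∷_; foldl; allFin)
open import Data.List.Relation.Unary.Unique.Propositional using (Unique)
open import Data.List.Relation.Unary.Unique.Propositional.Properties using (allFin⁺)
open import Data.List.Relation.Unary.AllPairs using (_∷_)
open import Data.List.Relation.Unary.All.Properties using (All¬⇒¬Any)
open import Data.List.Relation.Unary.Any using (here; there)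
open import Data.List.Membership.Propositional using (_∈_; _∉_)
open import Data.List.Membership.Propositional.Properties using (∈-allFin)
open import Data.Product using (_×_; _,_)
open import Data.Sum using (_⊎_; inj₁; inj₂)
open import Data.Empty using (⊥-elim)
open import Relation.Nullary using (yes; no)
open import Relation.Binary.PropositionalEquality
  using (_≡_; refl; sym; trans; cong; subst; module ≡-Reasoning)

mvpStep-free : ∀ {n} (i a : Fin n) (st : State n) →
  lookup st a ≡ nothing → mvpStep i a st ≡ just (st [ a ]≔ just i)
mvpStep-free i a st free rewrite free = refl

allParked-tabulate-just : ∀ {m n} (f : Fin m → Fin n) →
  allParked (tabulate (just ∘ f)) ≡ just (tabulate f)
allParked-tabulate-just {zero}  f = refl
allParked-tabulate-just {suc m} f rewrite allParked-tabulate-just (f ∘ suc) = refl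

module _ {n : ℕ} (π : Permutation′ n) where

  private
    α : Vec (Fin n) n
    α = tabulate (π ⟨$⟩ʳ_)

    step : Maybe (State n) → Fin n → Maybe (State n)
    step mst i = mst >>= mvpStep i (lookup α i)

  ParkedExcept : List (Fin n) → State n → Set
  ParkedExcept pending st = ∀ s →
    (π ⟨$⟩ˡ s ∈ pending × lookup st s ≡ nothing) ⊎
    (π ⟨$⟩ˡ s ∉ pending × lookup st s ≡ just (π ⟨$⟩ˡ s))

  parkedExcept-initial : ParkedExcept (allFin n) (replicate n nothing)
  parkedExcept-initial s = inj₁ (∈-allFin _ , lookup-replicate s nothing)

  parkedExcept-[] : ∀ {st} → ParkedExcept [] st → st ≡ tabulate (just ∘ (π ⟨$⟩ˡ_))
  parkedExcept-[] {st} parked = trans (sym (tabulate∘lookup st)) (tabulate-cong spot)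
    where
    spot : ∀ s → lookup st s ≡ just (π ⟨$⟩ˡ s)
    spot s with parked s
    ... | inj₁ (() , _)
    ... | inj₂ (_ , occupied) = occupied

  preferredSpot-free : ∀ {i pending st} → ParkedExcept (i ∷ pending) st →
    lookup st (π ⟨$⟩ʳ i) ≡ nothing
  preferredSpot-free {i} parked with parked (π ⟨$⟩ʳ i)
  ... | inj₁ (_ , free) = free
  ... | inj₂ (notPending , _) =
    ⊥-elim (notPending (subst (_∈ _) (sym (inverseˡ π)) (here refl)))

  parkedExcept-park : ∀ {i pending st} → Unique (i ∷ pending) → ParkedExcept (i ∷ pending) st →
    ParkedExcept pending (st [ π ⟨$⟩ʳ i ]≔ just i)
  parkedExcept-park {i} {pending} {st} (i∉pending ∷ _) parked s with π ⟨$⟩ʳ i ≟ s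
  ... | yes refl =
    inj₂ ( All¬⇒¬Any i∉pending ∘ subst (_∈ pending) (inverseˡ π)
         , trans (lookup∘update (π ⟨$⟩ʳ i) st (just i)) (cong just (sym (inverseˡ π))) )
  ... | no πi≢s with parked s
  ...   | inj₁ (here s≡πi , _) = ⊥-elim (πi≢s (trans (cong (π ⟨$⟩ʳ_) (sym s≡πi)) (inverseʳ π)))
  ...   | inj₁ (there pending∋ , free) = inj₁ (pending∋ , trans untouched free)
    where untouched = lookup∘update′ (πi≢s ∘ sym) st (just i)
  ...   | inj₂ (notPending , occupied) = inj₂ (notPending ∘ there , trans untouched occupied)
    where untouched = lookup∘update′ (πi≢s ∘ sym) st (just i)

  foldl-step-parkedExcept : ∀ pending st → Unique pending → ParkedExcept pending st →
    foldl step (just st) pending ≡ just (tabulate (just ∘ (π ⟨$⟩ˡ_)))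
  foldl-step-parkedExcept []            st _      parked = cong just (parkedExcept-[] parked)
  foldl-step-parkedExcept (i ∷ pending) st unique@(_ ∷ unique′) parked = begin
    foldl step (step (just st) i) pending
      ≡⟨ cong (λ mst → foldl step mst pending) parks ⟩
    foldl step (just st′) pending
      ≡⟨ foldl-step-parkedExcept pending st′ unique′ (parkedExcept-park {st = st} unique parked) ⟩
    just (tabulate (just ∘ (π ⟨$⟩ˡ_)))
      ∎
    where
    open ≡-Reasoning
    st′ = st [ π ⟨$⟩ʳ i ]≔ just i
    parks : step (just st) i ≡ just st′
    parks rewrite lookup∘tabulate (π ⟨$⟩ʳ_) i = mvpStep-free i _ st (preferredSpot-free {st = st} parked)

  mvpRun-permutation : mvpRun α ≡ just (tabulate (just ∘ (π ⟨$⟩ˡ_)))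
  mvpRun-permutation =
    foldl-step-parkedExcept (allFin n) (replicate n nothing) (allFin⁺ n) parkedExcept-initial

  mvpOutcome-permutation : mvpOutcome α ≡ just (tabulate (π ⟨$⟩ˡ_))
  mvpOutcome-permutation rewrite mvpRun-permutation = allParked-tabulate-just (π ⟨$⟩ˡ_)

corollary2p8 : (n : ℕ) (π : Permutation′ n) →
    (∀ i → π ⟨$⟩ʳ i ≡ π ⟨$⟩ˡ i) →
    mvpOutcome (tabulate (π ⟨$⟩ʳ_)) ≡ just (tabulate (π ⟨$⟩ʳ_))
corollary2p8 n π involution =
  trans (mvpOutcome-permutation π) (cong just (sym (tabulate-cong involution)))
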